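{- For any nonempty simplicial complexes $K$ (on $m$ vertices) and $L$, $$q_{K(L,\ldots,L)}(t)=q_K(q_L(t)),$$ where $K(L,\ldots,L)$ denotes the composition of $K$ with $m$ copies of $L$.
   Context: A simplicial complex on a finite set $V$ is a family of subsets of $V$ closed under taking subsets (ghost vertices allowed). For $K$ on $[m]$ and $K_i$ on $[l_i]$, the composition $K(K_1,\ldots,K_m)$ is the complex on $[l_1]\sqcup\cdots\sqcup[l_m]$ in which $I=I_1\sqcup\cdots\sqcup I_m$ ($I_i\subseteq[l_i]$) is a simplex iff $\{i\mid I_i\notin K_i\}\in K$. For a complex $K$ of dimension $n-1$ with $f_i=|\{I\in K\mid |I|=i\}|$, $f_K(t)=\sum f_it^i$, the $h$-polynomial is $h_K(t)=(1-t)^nf_K\big(\tfrac{t}{1-t}\big)$; if $K$ has $m$ vertices (counting ghost vertices) and dimension $n-1$, set $q_K(t)=1-(1-t)^{m-n}h_K(t)$. -}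

module Defs where

open import Data.Nat as ℕ using (ℕ; zero; suc; _⊔_; _∸_)
open import Data.Bool using (Bool; true; false; not; if_then_else_)
open import Data.Fin using (Fin; zero; suc)
open import Data.Fin.Subset using (Subset; _⊆_; ∣_∣) renaming (⊥ to ∅)
open import Data.Vec using (Vec; []; _∷_; tabulate; splitAt; take; drop)
open import Data.List using (List; []; _∷_; _++_; map; filter; foldr; length; upTo)
open import Data.Integer as ℤ using (ℤ; +_; _-_; _*_; _+_; _^_)
open import Relation.Binary.PropositionalEquality using (_≡_)
open import Relation.Nullary.Decidable using (yes; no)
open import Data.Bool.Properties using () renaming (_≟_ to _≟ᵇ_)
open import Data.Nat.Properties using () renaming (_≟_ to _≟ℕ_)
open import Relation.Nullary.Decidable using (⌊_⌋)

-- A family of subsets of Fin m, given by a decidable (Bool-valued)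
-- membership test.  Ghost vertices are allowed: m counts all vertices.
Family : ℕ → Set
Family m = Subset m → Bool

record SimplicialComplex (m : ℕ) : Set where
  field
    face   : Family m
    closed : ∀ (I J : Subset m) → J ⊆ I → face I ≡ true → face J ≡ true
open SimplicialComplex public

-- Nonempty: the complex is not the void complex, i.e. it contains ∅.
Nonempty : ∀ {m} → SimplicialComplex m → Set
Nonempty K = face K ∅ ≡ true

allSubsets : (m : ℕ) → List (Subset m)
allSubsets zero    = [] ∷ []
allSubsets (suc m) = map (false ∷_) (allSubsets m) ++ map (true ∷_) (allSubsets m)

faces : ∀ {m} → Family m → List (Subset m)
faces {m} F = filter (λ I → F I ≟ᵇ true) (allSubsets m)

fnum : ∀ {m} → Family m → ℕ → ℕ
fnum F i = length (filter (λ I → ∣ I ∣ ≟ℕ i) (faces F))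

dimPlus1 : ∀ {m} → Family m → ℕ
dimPlus1 F = foldr _⊔_ 0 (map ∣_∣ (faces F))

sumTo : ℕ → (ℕ → ℤ) → ℤ
sumTo zero    g = + 0
sumTo (suc k) g = sumTo k g + g k

-- h_K(t) = (1-t)^n f_K(t/(1-t)) = Σ_{i=0}^{n} f_i t^i (1-t)^(n-i),
-- as a polynomial function over ℤ.
hpoly : ∀ {m} → Family m → ℤ → ℤ
hpoly F t = sumTo (suc n) (λ i → + fnum F i * (t ^ i) * ((+ 1 - t) ^ (n ∸ i)))
  where n = dimPlus1 F

qpoly : ∀ {m} → Family m → ℤ → ℤ
qpoly {m} F t = + 1 - ((+ 1 - t) ^ (m ∸ dimPlus1 F)) * hpoly F t

-- Composition K(K_1,...,K_m).  Vertex set [l_1] ⊔ ... ⊔ [l_m] is Fin (total m l),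
-- laid out as consecutive blocks.
total : (m : ℕ) → (Fin m → ℕ) → ℕ
total zero    l = 0
total (suc m) l = l zero ℕ.+ total m (λ i → l (suc i))

block : (m : ℕ) (l : Fin m → ℕ) → Subset (total m l) → (i : Fin m) → Subset (l i)
block (suc m) l I zero    = take (l zero) I
block (suc m) l I (suc i) = block m (λ j → l (suc j)) (drop (l zero) I) i

compose : ∀ {m} (K : SimplicialComplex m) (l : Fin m → ℕ)
          (Ks : (i : Fin m) → SimplicialComplex (l i)) → Family (total m l)
compose {m} K l Ks I = face K (tabulate (λ i → not (face (Ks i) (block m l I i))))

composeSame : ∀ {m l} → SimplicialComplex m → SimplicialComplex l → Family (total m (λ _ → l))
composeSame {m} {l} K L = compose K (λ _ → l) (λ _ → L)

-- Read q_K probabilistically.  Draw a random subset I of the m vertices by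
-- including each vertex independently with "probability" t.  Then
-- (1-t)^(m-n) h_K(t) = Σ_{I ∈ K} t^|I| (1-t)^(m-|I|) is the probability that
-- I ∈ K, so q_K(t) is the probability that I ∉ K.  In K(L,…,L) the blocks I_i
-- are independent random subsets of [l], each outside L with probability
-- q_L(t); hence {i | I_i ∉ L} is a random subset of [m] with parameter q_L(t),
-- and I ∉ K(L,…,L) exactly when this set lies outside K.  The expectation is a
-- formal one (a polynomial identity over ℤ).
module Submission where

open import Defs
open import Data.Nat as ℕ using (ℕ; zero; suc; _∸_; _⊔_; _≤_; _<_; s≤s; z≤n)
import Data.Nat.Properties as ℕP
open import Data.Bool using (Bool; true; false; not)
open import Data.Fin.Subset using (Subset; ∣_∣)
open import Data.Fin.Subset.Properties using (∣p∣≤n)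
open import Data.Vec using (Vec; []; _∷_; tabulate; take; drop) renaming (_++_ to _++ᵥ_)
open import Data.Vec.Properties using (take++drop≡id; ++-injective)
open import Data.List using (List; []; _∷_; _++_; map; filter; foldr; length)
open import Data.List.Properties using (filter-accept; filter-reject)
open import Data.List.Relation.Unary.All as All using (All; []; _∷_)
open import Data.Product using (proj₁; proj₂)
open import Data.Integer using (ℤ; +_; _-_; _*_; _+_; _^_)
import Data.Integer.Properties as ℤP
open import Data.Integer.Tactic.RingSolver using (solve-∀)
open import Relation.Binary.PropositionalEquality using (_≡_; refl; sym; trans; cong; cong₂; module ≡-Reasoning)
open import Relation.Nullary using (yes; no)
open import Data.Bool.Properties using () renaming (_≟_ to _≟ᵇ_)
open import Data.Nat.Properties using () renaming (_≟_ to _≟ℕ_)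
open import Data.Empty using (⊥-elim)

open ≡-Reasoning

expect : (n : ℕ) → (Subset n → ℤ) → ℤ → ℤ
expect zero    g t = g []
expect (suc n) g t = (+ 1 - t) * expect n (λ I → g (false ∷ I)) t
                   + t * expect n (λ I → g (true ∷ I)) t

expect-cong : ∀ n {g h : Subset n → ℤ} t → (∀ I → g I ≡ h I) → expect n g t ≡ expect n h t
expect-cong zero    t g≗h = g≗h []
expect-cong (suc n) t g≗h = cong₂ (λ a b → (+ 1 - t) * a + t * b)
  (expect-cong n t (λ I → g≗h (false ∷ I))) (expect-cong n t (λ I → g≗h (true ∷ I)))

expect-++ : ∀ a b (g : Subset (a ℕ.+ b) → ℤ) t →
  expect (a ℕ.+ b) g t ≡ expect a (λ J → expect b (λ J′ → g (J ++ᵥ J′)) t) t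
expect-++ zero    b g t = refl
expect-++ (suc a) b g t = cong₂ (λ x y → (+ 1 - t) * x + t * y)
  (expect-++ a b (λ I → g (false ∷ I)) t) (expect-++ a b (λ I → g (true ∷ I)) t)

𝟙 : Bool → ℤ
𝟙 true  = + 1
𝟙 false = + 0

prob : ∀ {n} → Family n → ℤ → ℤ
prob {n} F t = expect n (λ I → 𝟙 (F I)) t

bool-interpolation : ∀ (φ : Bool → ℤ) b → φ b ≡ (+ 1 - 𝟙 b) * φ false + 𝟙 b * φ true
bool-interpolation φ true  = pick-true (φ false) (φ true)
  where
  pick-true : ∀ x y → y ≡ (+ 1 - + 1) * x + + 1 * y
  pick-true = solve-∀
bool-interpolation φ false = pick-false (φ false) (φ true)
  where
  pick-false : ∀ x y → x ≡ (+ 1 - + 0) * x + + 0 * y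
  pick-false = solve-∀

expect-bool : ∀ n (F : Family n) (φ : Bool → ℤ) t →
  expect n (λ I → φ (F I)) t ≡ (+ 1 - prob F t) * φ false + prob F t * φ true
expect-bool zero    F φ t = bool-interpolation φ (F [])
expect-bool (suc n) F φ t = begin
    (+ 1 - t) * expect n (λ I → φ (F₀ I)) t + t * expect n (λ I → φ (F₁ I)) t
  ≡⟨ cong₂ (λ a b → (+ 1 - t) * a + t * b) (expect-bool n F₀ φ t) (expect-bool n F₁ φ t) ⟩
    (+ 1 - t) * ((+ 1 - p₀) * φ false + p₀ * φ true) + t * ((+ 1 - p₁) * φ false + p₁ * φ true)
  ≡⟨ mix t p₀ p₁ (φ false) (φ true) ⟩
    (+ 1 - ((+ 1 - t) * p₀ + t * p₁)) * φ false + ((+ 1 - t) * p₀ + t * p₁) * φ true ∎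
  where
  F₀ F₁ : Family n
  F₀ I = F (false ∷ I)
  F₁ I = F (true ∷ I)
  p₀ = prob F₀ t
  p₁ = prob F₁ t
  mix : ∀ t p₀ p₁ x y →
    (+ 1 - t) * ((+ 1 - p₀) * x + p₀ * y) + t * ((+ 1 - p₁) * x + p₁ * y)
      ≡ (+ 1 - ((+ 1 - t) * p₀ + t * p₁)) * x + ((+ 1 - t) * p₀ + t * p₁) * y
  mix = solve-∀

outsideBlocks : ∀ m l → Family l → Subset (total m (λ _ → l)) → Subset m
outsideBlocks m l L I = tabulate (λ i → not (L (block m (λ _ → l) I i)))

take-++ : ∀ {A : Set} a {b} (xs : Vec A a) (ys : Vec A b) → take a (xs ++ᵥ ys) ≡ xs
take-++ a xs ys = proj₁ (++-injective (take a (xs ++ᵥ ys)) xs (take++drop≡id a (xs ++ᵥ ys)))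

drop-++ : ∀ {A : Set} a {b} (xs : Vec A a) (ys : Vec A b) → drop a (xs ++ᵥ ys) ≡ ys
drop-++ a xs ys = proj₂ (++-injective (take a (xs ++ᵥ ys)) xs (take++drop≡id a (xs ++ᵥ ys)))

outsideBlocks-++ : ∀ m l (L : Family l) J J′ →
  outsideBlocks (suc m) l L (J ++ᵥ J′) ≡ not (L J) ∷ outsideBlocks m l L J′
outsideBlocks-++ m l L J J′ rewrite take-++ l J J′ | drop-++ l J J′ = refl

expect-outsideBlocks : ∀ m l (L : Family l) (g : Subset m → ℤ) t →
  expect (total m (λ _ → l)) (λ I → g (outsideBlocks m l L I)) t ≡ expect m g (+ 1 - prob L t)
expect-outsideBlocks zero    l L g t = refl
expect-outsideBlocks (suc m) l L g t = begin
    expect (l ℕ.+ N) (λ I → g (outsideBlocks (suc m) l L I)) t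
  ≡⟨ expect-++ l N _ t ⟩
    expect l (λ J → expect N (λ J′ → g (outsideBlocks (suc m) l L (J ++ᵥ J′))) t) t
  ≡⟨ expect-cong l t (λ J → expect-cong N t (λ J′ → cong g (outsideBlocks-++ m l L J J′))) ⟩
    expect l (λ J → expect N (λ J′ → g (not (L J) ∷ outsideBlocks m l L J′)) t) t
  ≡⟨ expect-cong l t (λ J → expect-outsideBlocks m l L (λ S → g (not (L J) ∷ S)) t) ⟩
    expect l (λ J → h (not (L J))) t
  ≡⟨ expect-bool l L (λ b → h (not b)) t ⟩
    (+ 1 - p) * h true + p * h false
  ≡⟨ swap p (h true) (h false) ⟩
    (+ 1 - (+ 1 - p)) * h false + (+ 1 - p) * h true ∎
  where
  N = total m (λ _ → l)
  p = prob L t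
  h : Bool → ℤ
  h b = expect m (λ S → g (b ∷ S)) (+ 1 - p)
  swap : ∀ p x y → (+ 1 - p) * x + p * y ≡ (+ 1 - (+ 1 - p)) * y + (+ 1 - p) * x
  swap = solve-∀

sumMap : ∀ {A : Set} → (A → ℤ) → List A → ℤ
sumMap f []       = + 0
sumMap f (x ∷ xs) = f x + sumMap f xs

sumMap-cong : ∀ {A : Set} {f g : A → ℤ} xs → (∀ x → f x ≡ g x) → sumMap f xs ≡ sumMap g xs
sumMap-cong []       f≗g = refl
sumMap-cong (x ∷ xs) f≗g = cong₂ _+_ (f≗g x) (sumMap-cong xs f≗g)

sumMap-++ : ∀ {A : Set} (f : A → ℤ) xs ys → sumMap f (xs ++ ys) ≡ sumMap f xs + sumMap f ys
sumMap-++ f []       ys = sym (ℤP.+-identityˡ _)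
sumMap-++ f (x ∷ xs) ys = trans (cong (λ s → f x + s) (sumMap-++ f xs ys)) (sym (ℤP.+-assoc (f x) _ _))

sumMap-map : ∀ {A B : Set} (f : B → ℤ) (h : A → B) xs → sumMap f (map h xs) ≡ sumMap (λ x → f (h x)) xs
sumMap-map f h []       = refl
sumMap-map f h (x ∷ xs) = cong (λ s → f (h x) + s) (sumMap-map f h xs)

*-sumMap : ∀ {A : Set} c (f : A → ℤ) xs → c * sumMap f xs ≡ sumMap (λ x → c * f x) xs
*-sumMap c f []       = ℤP.*-zeroʳ c
*-sumMap c f (x ∷ xs) = trans (ℤP.*-distribˡ-+ c (f x) (sumMap f xs)) (cong (λ s → c * f x + s) (*-sumMap c f xs))

weight : ℕ → ℕ → ℤ → ℤ
weight m k t = t ^ k * (+ 1 - t) ^ (m ∸ k)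

weight-excluded : ∀ m k t → k ≤ m → (+ 1 - t) * weight m k t ≡ weight (suc m) k t
weight-excluded m k t k≤m rewrite ℕP.+-∸-assoc 1 k≤m = reorder t (t ^ k) ((+ 1 - t) ^ (m ∸ k))
  where
  reorder : ∀ t a b → (+ 1 - t) * (a * b) ≡ a * ((+ 1 - t) * b)
  reorder = solve-∀

weight-included : ∀ m k t → t * weight m k t ≡ weight (suc m) (suc k) t
weight-included m k t = sym (ℤP.*-assoc t (t ^ k) _)

expect≡sumMap-weight : ∀ m (g : Subset m → ℤ) t →
  expect m g t ≡ sumMap (λ I → g I * weight m ∣ I ∣ t) (allSubsets m)
expect≡sumMap-weight zero    g t = sym (trans (ℤP.+-identityʳ _) (ℤP.*-identityʳ (g [])))
expect≡sumMap-weight (suc m) g t = begin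
    (+ 1 - t) * expect m g₀ t + t * expect m g₁ t
  ≡⟨ cong₂ (λ a b → (+ 1 - t) * a + t * b) (expect≡sumMap-weight m g₀ t) (expect≡sumMap-weight m g₁ t) ⟩
    (+ 1 - t) * sumMap (λ I → g₀ I * weight m ∣ I ∣ t) A + t * sumMap (λ I → g₁ I * weight m ∣ I ∣ t) A
  ≡⟨ cong₂ _+_ (trans (*-sumMap (+ 1 - t) _ A) (sumMap-cong A excluded))
               (trans (*-sumMap t _ A) (sumMap-cong A included)) ⟩
    sumMap (λ I → f (false ∷ I)) A + sumMap (λ I → f (true ∷ I)) A
  ≡⟨ sym (cong₂ _+_ (sumMap-map f (false ∷_) A) (sumMap-map f (true ∷_) A)) ⟩
    sumMap f (map (false ∷_) A) + sumMap f (map (true ∷_) A)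
  ≡⟨ sym (sumMap-++ f (map (false ∷_) A) (map (true ∷_) A)) ⟩
    sumMap f (map (false ∷_) A ++ map (true ∷_) A) ∎
  where
  A = allSubsets m
  g₀ g₁ : Subset m → ℤ
  g₀ I = g (false ∷ I)
  g₁ I = g (true ∷ I)
  f : Subset (suc m) → ℤ
  f I = g I * weight (suc m) ∣ I ∣ t
  pull : ∀ c x w → c * (x * w) ≡ x * (c * w)
  pull = solve-∀
  excluded : ∀ I → (+ 1 - t) * (g₀ I * weight m ∣ I ∣ t) ≡ f (false ∷ I)
  excluded I = trans (pull (+ 1 - t) (g₀ I) _) (cong (g₀ I *_) (weight-excluded m ∣ I ∣ t (∣p∣≤n I)))
  included : ∀ I → t * (g₁ I * weight m ∣ I ∣ t) ≡ f (true ∷ I)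
  included I = trans (pull t (g₁ I) _) (cong (g₁ I *_) (weight-included m ∣ I ∣ t))

sumMap-𝟙-filter : ∀ {m} (F : Family m) (f : Subset m → ℤ) xs →
  sumMap (λ I → 𝟙 (F I) * f I) xs ≡ sumMap f (filter (λ I → F I ≟ᵇ true) xs)
sumMap-𝟙-filter F f []       = refl
sumMap-𝟙-filter F f (x ∷ xs) with F x
... | true  = cong₂ _+_ (ℤP.*-identityˡ (f x)) (sumMap-𝟙-filter F f xs)
... | false = trans (ℤP.+-identityˡ _) (sumMap-𝟙-filter F f xs)

sumTo-cong : ∀ k {f g : ℕ → ℤ} → (∀ i → i < k → f i ≡ g i) → sumTo k f ≡ sumTo k g
sumTo-cong zero    f≗g = refl
sumTo-cong (suc k) f≗g = cong₂ _+_ (sumTo-cong k (λ i i<k → f≗g i (ℕP.m≤n⇒m≤1+n i<k))) (f≗g k ℕP.≤-refl)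

sumTo-+ : ∀ k (f g : ℕ → ℤ) → sumTo k (λ i → f i + g i) ≡ sumTo k f + sumTo k g
sumTo-+ zero    f g = refl
sumTo-+ (suc k) f g = trans (cong (_+ (f k + g k)) (sumTo-+ k f g)) (interchange (sumTo k f) (sumTo k g) (f k) (g k))
  where
  interchange : ∀ a b c d → a + b + (c + d) ≡ a + c + (b + d)
  interchange = solve-∀

*-sumTo : ∀ k c (f : ℕ → ℤ) → c * sumTo k f ≡ sumTo k (λ i → c * f i)
*-sumTo zero    c f = ℤP.*-zeroʳ c
*-sumTo (suc k) c f = trans (ℤP.*-distribˡ-+ c _ _) (cong (_+ c * f k) (*-sumTo k c f))

onlyAt : ℕ → (ℕ → ℤ) → ℕ → ℤ
onlyAt a W i with a ≟ℕ i
... | yes _ = W i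
... | no  _ = + 0

sumTo-onlyAt-≤ : ∀ a W k → k ≤ a → sumTo k (onlyAt a W) ≡ + 0
sumTo-onlyAt-≤ a W zero    k≤a = refl
sumTo-onlyAt-≤ a W (suc k) k<a with a ≟ℕ k
... | yes refl = ⊥-elim (ℕP.<-irrefl refl k<a)
... | no  _    = cong (_+ + 0) (sumTo-onlyAt-≤ a W k (ℕP.<⇒≤ k<a))

sumTo-onlyAt-< : ∀ a W k → a < k → sumTo k (onlyAt a W) ≡ W a
sumTo-onlyAt-< a W (suc k) (s≤s a≤k) with a ≟ℕ k
... | yes refl = trans (cong (_+ W a) (sumTo-onlyAt-≤ a W a ℕP.≤-refl)) (ℤP.+-identityˡ (W a))
... | no  a≢k  = trans (cong (_+ + 0) (sumTo-onlyAt-< a W k (ℕP.≤∧≢⇒< a≤k a≢k))) (ℤP.+-identityʳ _)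

countCard : ∀ {m} → List (Subset m) → ℕ → ℕ
countCard xs i = length (filter (λ x → ∣ x ∣ ≟ℕ i) xs)

onlyAt-+-countCard : ∀ {m} (x : Subset m) xs W i →
  onlyAt ∣ x ∣ W i + + countCard xs i * W i ≡ + countCard (x ∷ xs) i * W i
onlyAt-+-countCard x xs W i with ∣ x ∣ ≟ℕ i
... | yes ∣x∣≡i = trans (succ-* (+ countCard xs i) (W i))
                       (cong (λ ys → + length ys * W i) (sym (filter-accept (λ y → ∣ y ∣ ≟ℕ i) {x} {xs} ∣x∣≡i)))
  where
  succ-* : ∀ c w → w + c * w ≡ (+ 1 + c) * w
  succ-* = solve-∀
... | no  ∣x∣≢i = trans (ℤP.+-identityˡ _)
                       (cong (λ ys → + length ys * W i) (sym (filter-reject (λ y → ∣ y ∣ ≟ℕ i) {x} {xs} ∣x∣≢i)))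

sumMap-byCard : ∀ {m} n (W : ℕ → ℤ) (xs : List (Subset m)) → All (λ x → ∣ x ∣ ≤ n) xs →
  sumMap (λ x → W ∣ x ∣) xs ≡ sumTo (suc n) (λ i → + countCard xs i * W i)
sumMap-byCard n W []       []         = trans (sym (ℤP.*-zeroˡ (sumTo (suc n) W))) (*-sumTo (suc n) (+ 0) W)
sumMap-byCard n W (x ∷ xs) (x≤n ∷ xs≤n) = begin
    W ∣ x ∣ + sumMap (λ x → W ∣ x ∣) xs
  ≡⟨ cong₂ _+_ (sym (sumTo-onlyAt-< ∣ x ∣ W (suc n) (s≤s x≤n))) (sumMap-byCard n W xs xs≤n) ⟩
    sumTo (suc n) (onlyAt ∣ x ∣ W) + sumTo (suc n) (λ i → + countCard xs i * W i)
  ≡⟨ sym (sumTo-+ (suc n) (onlyAt ∣ x ∣ W) _) ⟩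
    sumTo (suc n) (λ i → onlyAt ∣ x ∣ W i + + countCard xs i * W i)
  ≡⟨ sumTo-cong (suc n) (λ i _ → onlyAt-+-countCard x xs W i) ⟩
    sumTo (suc n) (λ i → + countCard (x ∷ xs) i * W i) ∎

maxCard : ∀ {m} → List (Subset m) → ℕ
maxCard xs = foldr _⊔_ 0 (map ∣_∣ xs)

card≤maxCard : ∀ {m} (xs : List (Subset m)) → All (λ x → ∣ x ∣ ≤ maxCard xs) xs
card≤maxCard []       = []
card≤maxCard (x ∷ xs) = ℕP.m≤m⊔n ∣ x ∣ (maxCard xs)
                      ∷ All.map (λ p → ℕP.≤-trans p (ℕP.m≤n⊔m ∣ x ∣ (maxCard xs))) (card≤maxCard xs)

maxCard≤ : ∀ {m} (xs : List (Subset m)) → maxCard xs ≤ m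
maxCard≤ []       = z≤n
maxCard≤ (x ∷ xs) = ℕP.⊔-lub (∣p∣≤n x) (maxCard≤ xs)

weight-split : ∀ m n i t → i ≤ n → n ≤ m →
  (+ 1 - t) ^ (m ∸ n) * (t ^ i * (+ 1 - t) ^ (n ∸ i)) ≡ weight m i t
weight-split m n i t i≤n n≤m = begin
    (+ 1 - t) ^ (m ∸ n) * (t ^ i * (+ 1 - t) ^ (n ∸ i))
  ≡⟨ reorder (t ^ i) ((+ 1 - t) ^ (m ∸ n)) ((+ 1 - t) ^ (n ∸ i)) ⟩
    t ^ i * ((+ 1 - t) ^ (m ∸ n) * (+ 1 - t) ^ (n ∸ i))
  ≡⟨ cong (t ^ i *_) (sym (ℤP.^-distribˡ-+-* (+ 1 - t) (m ∸ n) (n ∸ i))) ⟩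
    t ^ i * (+ 1 - t) ^ ((m ∸ n) ℕ.+ (n ∸ i))
  ≡⟨ cong (λ e → t ^ i * (+ 1 - t) ^ e) exponent ⟩
    weight m i t ∎
  where
  reorder : ∀ a b c → b * (a * c) ≡ a * (b * c)
  reorder = solve-∀
  exponent : (m ∸ n) ℕ.+ (n ∸ i) ≡ m ∸ i
  exponent = trans (sym (ℕP.+-∸-assoc (m ∸ n) i≤n)) (cong (_∸ i) (ℕP.m∸n+n≡m n≤m))

*-hTerms : ∀ m n t (f : ℕ → ℕ) → n ≤ m →
  (+ 1 - t) ^ (m ∸ n) * sumTo (suc n) (λ i → + f i * (t ^ i) * ((+ 1 - t) ^ (n ∸ i)))
    ≡ sumTo (suc n) (λ i → + f i * weight m i t)
*-hTerms m n t f n≤m = trans (*-sumTo (suc n) c _) (sumTo-cong (suc n) term)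
  where
  c = (+ 1 - t) ^ (m ∸ n)
  reorder : ∀ c x a b → c * (x * a * b) ≡ x * (c * (a * b))
  reorder = solve-∀
  term : ∀ i → i < suc n → c * (+ f i * (t ^ i) * ((+ 1 - t) ^ (n ∸ i))) ≡ + f i * weight m i t
  term i (s≤s i≤n) = trans (reorder c (+ f i) (t ^ i) _) (cong (+ f i *_) (weight-split m n i t i≤n n≤m))

hpoly≡prob : ∀ {m} (F : Family m) t → (+ 1 - t) ^ (m ∸ dimPlus1 F) * hpoly F t ≡ prob F t
hpoly≡prob {m} F t = begin
    (+ 1 - t) ^ (m ∸ n) * hpoly F t
  ≡⟨ *-hTerms m n t (fnum F) (maxCard≤ (faces F)) ⟩
    sumTo (suc n) (λ i → + fnum F i * weight m i t)
  ≡⟨ sym (sumMap-byCard n (λ k → weight m k t) (faces F) (card≤maxCard (faces F))) ⟩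
    sumMap (λ I → weight m ∣ I ∣ t) (faces F)
  ≡⟨ sym (sumMap-𝟙-filter F (λ I → weight m ∣ I ∣ t) (allSubsets m)) ⟩
    sumMap (λ I → 𝟙 (F I) * weight m ∣ I ∣ t) (allSubsets m)
  ≡⟨ sym (expect≡sumMap-weight m (λ I → 𝟙 (F I)) t) ⟩
    prob F t ∎
  where
  n = dimPlus1 F

qpoly≡1-prob : ∀ {m} (F : Family m) t → qpoly F t ≡ + 1 - prob F t
qpoly≡1-prob F t = cong (+ 1 -_) (hpoly≡prob F t)

mainTheorem17 : ∀ {m l : ℕ} (K : SimplicialComplex m) (L : SimplicialComplex l) →
    Nonempty K → Nonempty L →
    ∀ (t : ℤ) → qpoly (composeSame K L) t ≡ qpoly (face K) (qpoly (face L) t)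
mainTheorem17 {m} {l} K L _ _ t = begin
    qpoly (composeSame K L) t
  ≡⟨ qpoly≡1-prob (composeSame K L) t ⟩
    + 1 - prob (composeSame K L) t
  ≡⟨ cong (+ 1 -_) (expect-outsideBlocks m l (face L) (λ S → 𝟙 (face K S)) t) ⟩
    + 1 - prob (face K) (+ 1 - prob (face L) t)
  ≡⟨ cong (λ s → + 1 - prob (face K) s) (sym (qpoly≡1-prob (face L) t)) ⟩
    + 1 - prob (face K) (qpoly (face L) t)
  ≡⟨ sym (qpoly≡1-prob (face K) (qpoly (face L) t)) ⟩
    qpoly (face K) (qpoly (face L) t) ∎
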